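{- Let $f:\mathbb{F}_2^n\to\{0,1\}$ and $\epsilon>0$. Then: (a) $f$ is odd-cycle-free if and only if there exists $\alpha\in\mathbb{F}_2^n$ such that $\alpha\cdot x=1$ for all $x\in\mathrm{supp}(f)$. (b) $f$ is $\epsilon$-far from odd-cycle-free if and only if for every $\alpha\in\mathbb{F}_2^n$, at least $\epsilon 2^n$ elements $x\in\mathrm{supp}(f)$ satisfy $\alpha\cdot x=0$.
   Context: $\mathrm{supp}(f)=\{x\in\mathbb{F}_2^n: f(x)\ne0\}$ and $\alpha\cdot x=\sum_i\alpha_ix_i\in\mathbb{F}_2$. A function $f:\mathbb{F}_2^n\to\{0,1\}$ is odd-cycle-free (OCF) if for every odd $k\ge1$ there are no $x_1,\ldots,x_k\in\mathbb{F}_2^n$ with $x_1+\cdots+x_k=0$ and $f(x_i)=1$ for all $i$. $f$ is $\epsilon$-far from OCF if $\Pr_x[f(x)\ne g(x)]\ge\epsilon$ ($x$ uniform) for every OCF $g$.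
   Formalization: The parameter ε ranges over the positive rationals. -}

module Defs where

open import Data.Bool using (Bool; true; false; _xor_; _∧_; not)
open import Data.Nat using (ℕ; zero; suc; _^_; _%_)
open import Data.Nat.Properties using (m^n≢0)
open import Data.Integer using (+_)
open import Data.Rational using (ℚ; _/_; _≤_; _*_)
open import Data.Vec using (Vec; []; _∷_; replicate; zipWith; foldr)
open import Data.List using (List; []; _∷_; _++_; map; length; filter)
open import Data.List.Relation.Unary.All using (All)
open import Data.Product using (Σ; _×_)
open import Relation.Binary.PropositionalEquality using (_≡_)
open import Relation.Nullary using (¬_)
open import Data.Bool using (T)
open import Relation.Nullary.Decidable using (Dec)
open import Data.Bool.Properties using (T?)

-- F₂ is Bool (false = 0, true = 1, addition = xor, multiplication = ∧)
-- F₂^n is Vec Bool n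
𝔽₂^ : ℕ → Set
𝔽₂^ n = Vec Bool n

0v : ∀ {n} → 𝔽₂^ n
0v = replicate _ false

_⊕_ : ∀ {n} → 𝔽₂^ n → 𝔽₂^ n → 𝔽₂^ n
_⊕_ = zipWith _xor_

Σv : ∀ {n} → List (𝔽₂^ n) → 𝔽₂^ n
Σv [] = 0v
Σv (x ∷ xs) = x ⊕ Σv xs

_·_ : ∀ {n} → 𝔽₂^ n → 𝔽₂^ n → Bool
α · x = foldr _ _xor_ false (zipWith _∧_ α x)

allVecs : (n : ℕ) → List (𝔽₂^ n)
allVecs zero = [] ∷ []
allVecs (suc n) = map (false ∷_) (allVecs n) ++ map (true ∷_) (allVecs n)

count : ∀ {n} → (𝔽₂^ n → Bool) → ℕ
count {n} P = length (filter (λ x → T? (P x)) (allVecs n))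

Odd : ℕ → Set
Odd k = k % 2 ≡ 1

OCF : ∀ {n} → (𝔽₂^ n → Bool) → Set
OCF {n} f = (xs : List (𝔽₂^ n)) → Odd (length xs) → Σv xs ≡ 0v →
            ¬ All (λ x → f x ≡ true) xs

Prdiff : ∀ {n} → (𝔽₂^ n → Bool) → (𝔽₂^ n → Bool) → ℚ
Prdiff {n} f g = _/_ (+ count (λ x → f x xor g x)) (2 ^ n) {{m^n≢0 2 n}}

Far : ∀ {n} → ℚ → (𝔽₂^ n → Bool) → Set
Far {n} ε f = (g : 𝔽₂^ n → Bool) → OCF g → ε ≤ Prdiff f g

-- If the support of f lies in a hyperplane α · x = 1, an odd number of support points sums
-- to some s with α · s = 1, so s ≠ 0 and f is odd-cycle-free. Conversely, Gaussian
-- elimination over F₂ on the system α · x = 1 (x ∈ supp f), keeping track of which equations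
-- are combined, yields either a solution α or a combination of equations reading 0 = 1:
-- an odd list of support points summing to 0. For (b), the odd-cycle-free function nearest
-- to f is f restricted to such a hyperplane, at distance #{x ∈ supp f : α · x = 0} / 2ⁿ.
module Submission where

open import Defs
open import Data.Bool using (Bool; true; false; _∧_; not; _xor_; T)
open import Data.Bool.Properties
  using (T?; T-≡; ¬-not; not-involutive; xor-assoc; xor-comm; xor-same;
         ∧-zeroʳ; ∧-identityʳ; ∧-conicalʳ; ∧-distribˡ-xor; xor-∧-commutativeRing)
  renaming (_≟_ to _≟ᵇ_)
open import Data.Nat as ℕ using (ℕ; zero; suc; _^_)
import Data.Nat.Properties as ℕ
open import Data.Integer as ℤ using (+_)
import Data.Integer.Properties as ℤ
open import Data.Rational using (ℚ; _/_; _≤_; _<_; _*_; 0ℚ; toℚᵘ; Positive; NonNegative)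
open import Data.Rational.Properties
  using (toℚᵘ-injective; toℚᵘ-homo-*; toℚᵘ-fromℚᵘ; toℚᵘ-cancel-≤;
         *-cancelʳ-≤-pos; *-monoʳ-≤-nonNeg; normalize-pos; pos⇒nonNeg; ≤-trans)
open import Data.Rational.Unnormalised as ℚᵘ using (mkℚᵘ; *≡*; *≤*)
import Data.Rational.Unnormalised.Properties as ℚᵘ
open import Data.Product using (Σ; _×_; _,_; proj₂)
open import Data.Sum using (_⊎_; inj₁; inj₂) renaming (map to map⊎)
open import Data.Empty using (⊥-elim)
open import Data.Vec using ([]; _∷_; head; tail)
open import Data.Vec.Properties using (zipWith-assoc)
open import Data.List using (List; []; _∷_; map; length; filter)
open import Data.List.Properties using (filter-≐)
open import Data.List.Relation.Unary.All as All using (All; []; _∷_)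
open import Data.List.Relation.Unary.All.Properties using (¬Any⇒All¬)
open import Data.List.Relation.Unary.Any using (here; any?)
open import Data.List.Membership.Propositional using (_∈_; find)
open import Data.List.Membership.Propositional.Properties
  using (∈-map⁺; ∈-++⁺ˡ; ∈-++⁺ʳ; ∈-filter⁺; ∈-filter⁻)
open import Data.List.Relation.Binary.Sublist.Propositional using (⊆-refl)
open import Data.List.Relation.Binary.Sublist.Propositional.Properties using (filter⁺; length-mono-≤)
open import Algebra.Bundles using (CommutativeRing)
open import Algebra.Properties.CommutativeSemigroup
  (CommutativeRing.+-commutativeSemigroup xor-∧-commutativeRing) using (interchange)
open import Function using (_∘_)
open import Function.Bundles using (_⇔_; mk⇔; Equivalence)
open import Relation.Binary.PropositionalEquality
open import Relation.Nullary using (yes; no)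

private
  variable
    m n : ℕ

⊕-assoc : (x y z : 𝔽₂^ n) → (x ⊕ y) ⊕ z ≡ x ⊕ (y ⊕ z)
⊕-assoc = zipWith-assoc xor-assoc

·-zeroʳ : (α : 𝔽₂^ n) → α · 0v ≡ false
·-zeroʳ [] = refl
·-zeroʳ (a ∷ α) rewrite ∧-zeroʳ a = ·-zeroʳ α

·-distribˡ-⊕ : (α x y : 𝔽₂^ n) → α · (x ⊕ y) ≡ (α · x) xor (α · y)
·-distribˡ-⊕ [] [] [] = refl
·-distribˡ-⊕ (a ∷ α) (u ∷ x) (v ∷ y) = begin
  (a ∧ (u xor v)) xor (α · (x ⊕ y))                ≡⟨ cong₂ _xor_ (∧-distribˡ-xor a u v) (·-distribˡ-⊕ α x y) ⟩
  ((a ∧ u) xor (a ∧ v)) xor ((α · x) xor (α · y))  ≡⟨ interchange (a ∧ u) (a ∧ v) (α · x) (α · y) ⟩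
  ((a ∧ u) xor (α · x)) xor ((a ∧ v) xor (α · y))  ∎
  where open ≡-Reasoning

parity : ℕ → Bool
parity zero    = false
parity (suc k) = not (parity k)

parity≡true⇒Odd : ∀ k → parity k ≡ true → Odd k
parity≡true⇒Odd (suc zero)    _ = refl
parity≡true⇒Odd (suc (suc k)) p = parity≡true⇒Odd k (trans (sym (not-involutive (parity k))) p)

Odd⇒parity≡true : ∀ k → Odd k → parity k ≡ true
Odd⇒parity≡true (suc zero)    _ = refl
Odd⇒parity≡true (suc (suc k)) o = trans (not-involutive (parity k)) (Odd⇒parity≡true k o)

Σv-map-true∷ : (xs : List (𝔽₂^ n)) → Σv (map (true ∷_) xs) ≡ parity (length xs) ∷ Σv xs
Σv-map-true∷ []       = refl
Σv-map-true∷ (x ∷ xs) rewrite Σv-map-true∷ xs = refl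

·-Σv : (α : 𝔽₂^ n) (xs : List (𝔽₂^ n)) →
       All (λ x → α · x ≡ true) xs → α · Σv xs ≡ parity (length xs)
·-Σv α []       []         = ·-zeroʳ α
·-Σv α (x ∷ xs) (αx ∷ αxs) = begin
  α · (x ⊕ Σv xs)          ≡⟨ ·-distribˡ-⊕ α x (Σv xs) ⟩
  (α · x) xor α · Σv xs    ≡⟨ cong₂ _xor_ αx (·-Σv α xs αxs) ⟩
  not (parity (length xs)) ∎
  where open ≡-Reasoning

-- The row b ∷ y encodes the equation α · y = b.
Solves : 𝔽₂^ n → 𝔽₂^ (suc n) → Set
Solves α (b ∷ y) = α · y ≡ b

module _ {A : Set} where

  Solution : List A → (A → 𝔽₂^ (suc n)) → Set
  Solution {n} S e = Σ (𝔽₂^ n) λ α → ∀ {a} → a ∈ S → Solves α (e a)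

  -- equations of the system adding up to 0 = 1
  Refutation : List A → (A → 𝔽₂^ (suc n)) → Set
  Refutation S e = Σ (List A) λ zs → All (_∈ S) zs × Σv (map e zs) ≡ true ∷ 0v

coeff₀ : 𝔽₂^ (suc (suc m)) → Bool
coeff₀ (_ ∷ c ∷ _) = c

widen : 𝔽₂^ (suc m) → 𝔽₂^ (suc (suc m))
widen (b ∷ y) = b ∷ false ∷ y

widen-⊕ : (u v : 𝔽₂^ (suc m)) → widen (u ⊕ v) ≡ widen u ⊕ widen v
widen-⊕ (_ ∷ _) (_ ∷ _) = refl

eliminate : (p u : 𝔽₂^ (suc (suc m))) → 𝔽₂^ (suc m)
eliminate p              (b ∷ false ∷ y) = b ∷ y
eliminate (pb ∷ _ ∷ py) (b ∷ true ∷ y)  = (b xor pb) ∷ (y ⊕ py)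

widen-eliminate-false : (p u : 𝔽₂^ (suc (suc m))) → coeff₀ u ≡ false → widen (eliminate p u) ≡ u
widen-eliminate-false p (_ ∷ false ∷ _) _ = refl

widen-eliminate-true : (p u : 𝔽₂^ (suc (suc m))) → coeff₀ p ≡ true → coeff₀ u ≡ true →
                       widen (eliminate p u) ≡ u ⊕ p
widen-eliminate-true (_ ∷ true ∷ _) (_ ∷ true ∷ _) _ _ = refl

backSubstitute : 𝔽₂^ m → 𝔽₂^ (suc (suc m)) → 𝔽₂^ (suc m)
backSubstitute α (pb ∷ _ ∷ py) = (pb xor (α · py)) ∷ α

xor-cancelˡ : ∀ x y → x xor (y xor x) ≡ y
xor-cancelˡ x y = trans (cong (x xor_) (xor-comm y x)) (trans (sym (xor-assoc x x y))
                    (cong (_xor y) (xor-same x)))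

Solves-backSubstitute : (α : 𝔽₂^ m) (p u : 𝔽₂^ (suc (suc m))) →
                        Solves α (eliminate p u) → Solves (backSubstitute α p) u
Solves-backSubstitute α (pb ∷ _ ∷ py) (b ∷ false ∷ y) sol
  rewrite ∧-zeroʳ (pb xor (α · py)) = sol
Solves-backSubstitute α (pb ∷ _ ∷ py) (b ∷ true ∷ y) sol = begin
  ((pb xor (α · py)) ∧ true) xor (α · y) ≡⟨ cong (_xor (α · y)) (∧-identityʳ (pb xor (α · py))) ⟩
  (pb xor (α · py)) xor (α · y)          ≡⟨ xor-assoc pb (α · py) (α · y) ⟩
  pb xor ((α · py) xor (α · y))          ≡⟨ cong (pb xor_) (xor-comm (α · py) (α · y)) ⟩
  pb xor ((α · y) xor (α · py))          ≡⟨ cong (pb xor_) (sym (·-distribˡ-⊕ α y py)) ⟩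
  pb xor (α · (y ⊕ py))                  ≡⟨ cong (pb xor_) sol ⟩
  pb xor (b xor pb)                      ≡⟨ xor-cancelˡ pb b ⟩
  b                                      ∎
  where open ≡-Reasoning

module _ {A : Set} {S : List A} (e : A → 𝔽₂^ (suc (suc m))) where

  Solution-backSubstitute : ∀ p → Solution S (eliminate p ∘ e) → Solution S e
  Solution-backSubstitute p (α , sol) =
    backSubstitute α p , λ {a} a∈S → Solves-backSubstitute α p (e a) (sol a∈S)

  Σv-eliminate-free : ∀ p zs → All (λ a → coeff₀ (e a) ≡ false) zs →
                      Σv (map e zs) ≡ widen (Σv (map (eliminate p ∘ e) zs))
  Σv-eliminate-free p []       []          = refl
  Σv-eliminate-free p (z ∷ zs) (free ∷ fs) = begin
    e z ⊕ Σv (map e zs)                                        ≡⟨ cong₂ _⊕_ (sym (widen-eliminate-false p (e z) free))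
                                                                            (Σv-eliminate-free p zs fs) ⟩
    widen (eliminate p (e z)) ⊕ widen (Σv (map (eliminate p ∘ e) zs)) ≡⟨ sym (widen-⊕ _ _) ⟩
    widen (Σv (map (eliminate p ∘ e) (z ∷ zs)))               ∎
    where open ≡-Reasoning

  Refutation-free : ∀ p → (∀ {a} → a ∈ S → coeff₀ (e a) ≡ false) →
                    Refutation S (eliminate p ∘ e) → Refutation S e
  Refutation-free p free (zs , zs⊆S , Σ≡) =
    zs , zs⊆S , trans (Σv-eliminate-free p zs (All.map free zs⊆S)) (cong widen Σ≡)

  module Pivot (p : A) (p-pivot : coeff₀ (e p) ≡ true) where

    -- eliminating with the pivot row adds e p to every row whose first coefficient is 1
    insertPivot : List A → List A
    insertPivot []       = []
    insertPivot (z ∷ zs) with coeff₀ (e z)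
    ... | true  = z ∷ p ∷ insertPivot zs
    ... | false = z ∷ insertPivot zs

    insertPivot-⊆ : p ∈ S → ∀ zs → All (_∈ S) zs → All (_∈ S) (insertPivot zs)
    insertPivot-⊆ p∈S []       []          = []
    insertPivot-⊆ p∈S (z ∷ zs) (z∈S ∷ zs⊆S) with coeff₀ (e z)
    ... | true  = z∈S ∷ p∈S ∷ insertPivot-⊆ p∈S zs zs⊆S
    ... | false = z∈S ∷ insertPivot-⊆ p∈S zs zs⊆S

    Σv-insertPivot : ∀ zs → Σv (map e (insertPivot zs)) ≡ widen (Σv (map (eliminate (e p) ∘ e) zs))
    Σv-insertPivot []       = refl
    Σv-insertPivot (z ∷ zs) with coeff₀ (e z) in z-coeff
    ... | true = begin
      e z ⊕ (e p ⊕ Σv (map e (insertPivot zs)))   ≡⟨ sym (⊕-assoc (e z) (e p) _) ⟩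
      (e z ⊕ e p) ⊕ Σv (map e (insertPivot zs))   ≡⟨ cong₂ _⊕_ (sym (widen-eliminate-true (e p) (e z) p-pivot z-coeff))
                                                              (Σv-insertPivot zs) ⟩
      widen (eliminate (e p) (e z)) ⊕ widen (Σv (map (eliminate (e p) ∘ e) zs)) ≡⟨ sym (widen-⊕ _ _) ⟩
      widen (Σv (map (eliminate (e p) ∘ e) (z ∷ zs))) ∎
      where open ≡-Reasoning
    ... | false = begin
      e z ⊕ Σv (map e (insertPivot zs))           ≡⟨ cong₂ _⊕_ (sym (widen-eliminate-false (e p) (e z) z-coeff))
                                                              (Σv-insertPivot zs) ⟩
      widen (eliminate (e p) (e z)) ⊕ widen (Σv (map (eliminate (e p) ∘ e) zs)) ≡⟨ sym (widen-⊕ _ _) ⟩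
      widen (Σv (map (eliminate (e p) ∘ e) (z ∷ zs))) ∎
      where open ≡-Reasoning

    Refutation-insertPivot : p ∈ S → Refutation S (eliminate (e p) ∘ e) → Refutation S e
    Refutation-insertPivot p∈S (zs , zs⊆S , Σ≡) =
      insertPivot zs , insertPivot-⊆ p∈S zs zs⊆S , trans (Σv-insertPivot zs) (cong widen Σ≡)

Solves-[] : (u : 𝔽₂^ 1) → head u ≡ false → Solves [] u
Solves-[] (false ∷ []) refl = refl

Σv-[_] : (u : 𝔽₂^ 1) → head u ≡ true → Σv (u ∷ []) ≡ true ∷ 0v
Σv-[ true ∷ [] ] refl = refl

solveOrRefute : ∀ n {A : Set} (S : List A) (e : A → 𝔽₂^ (suc n)) → Solution S e ⊎ Refutation S e
solveOrRefute zero S e with any? (λ a → head (e a) ≟ᵇ true) S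
... | yes bad = let a , a∈S , ea≡1 = find bad in inj₂ (a ∷ [] , a∈S ∷ [] , Σv-[ e a ] ea≡1)
... | no  ok  = inj₁ ([] , λ {a} a∈S → Solves-[] (e a) (¬-not (All.lookup (¬Any⇒All¬ S ok) a∈S)))
solveOrRefute (suc m) S e with any? (λ a → coeff₀ (e a) ≟ᵇ true) S
... | yes pivots = let p , p∈S , p-pivot = find pivots; open Pivot e p p-pivot in
  map⊎ (Solution-backSubstitute e (e p)) (Refutation-insertPivot p∈S)
       (solveOrRefute m S (eliminate (e p) ∘ e))
... | no  none   =
  -- all first coefficients vanish, so the pivot argument 0v of eliminate is never used
  map⊎ (Solution-backSubstitute e 0v)
       (Refutation-free e 0v (λ a∈S → ¬-not (All.lookup (¬Any⇒All¬ S none) a∈S)))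
       (solveOrRefute m S (eliminate 0v ∘ e))

allVecs-complete : ∀ n (x : 𝔽₂^ n) → x ∈ allVecs n
allVecs-complete zero    []          = here refl
allVecs-complete (suc n) (false ∷ x) = ∈-++⁺ˡ (∈-map⁺ (false ∷_) (allVecs-complete n x))
allVecs-complete (suc n) (true ∷ x)  =
  ∈-++⁺ʳ (map (false ∷_) (allVecs n)) (∈-map⁺ (true ∷_) (allVecs-complete n x))

support : (𝔽₂^ n → Bool) → List (𝔽₂^ n)
support {n} f = filter (T? ∘ f) (allVecs n)

∈-support⁺ : (f : 𝔽₂^ n → Bool) {x : 𝔽₂^ n} → f x ≡ true → x ∈ support f
∈-support⁺ {n} f {x} fx = ∈-filter⁺ (T? ∘ f) (allVecs-complete n x) (Equivalence.from T-≡ fx)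

∈-support⁻ : (f : 𝔽₂^ n → Bool) {x : 𝔽₂^ n} → x ∈ support f → f x ≡ true
∈-support⁻ {n} f x∈ = Equivalence.to T-≡ (proj₂ (∈-filter⁻ (T? ∘ f) {xs = allVecs n} x∈))

OddOn : 𝔽₂^ n → (𝔽₂^ n → Bool) → Set
OddOn {n} α f = (x : 𝔽₂^ n) → f x ≡ true → α · x ≡ true

OddOn⇒OCF : (f : 𝔽₂^ n → Bool) (α : 𝔽₂^ n) → OddOn α f → OCF f
OddOn⇒OCF f α αodd xs odd Σ≡0 fxs = false≢true (begin
  false                  ≡⟨ sym (·-zeroʳ α) ⟩
  α · 0v                 ≡⟨ cong (α ·_) (sym Σ≡0) ⟩
  α · Σv xs              ≡⟨ ·-Σv α xs (All.map (αodd _) fxs) ⟩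
  parity (length xs)     ≡⟨ Odd⇒parity≡true (length xs) odd ⟩
  true                   ∎)
  where
  open ≡-Reasoning
  false≢true : false ≢ true
  false≢true ()

OCF⇒OddOn : (f : 𝔽₂^ n → Bool) → OCF f → Σ (𝔽₂^ n) λ α → OddOn α f
OCF⇒OddOn {n} f ocf with solveOrRefute n (support f) (true ∷_)
... | inj₁ (α , sol) = α , λ x fx → sol (∈-support⁺ f fx)
... | inj₂ (xs , xs⊆supp , Σ≡) = ⊥-elim (ocf xs odd (cong tail Σ≡′) (All.map (∈-support⁻ f) xs⊆supp))
  where
  Σ≡′ : parity (length xs) ∷ Σv xs ≡ true ∷ 0v
  Σ≡′ = trans (sym (Σv-map-true∷ xs)) Σ≡
  odd : Odd (length xs)
  odd = parity≡true⇒Odd (length xs) (cong head Σ≡′)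

OCF⇔OddOn : (f : 𝔽₂^ n → Bool) → OCF f ⇔ Σ (𝔽₂^ n) λ α → OddOn α f
OCF⇔OddOn f = mk⇔ (OCF⇒OddOn f) (λ (α , αodd) → OddOn⇒OCF f α αodd)

count-cong : {P Q : 𝔽₂^ n → Bool} → (∀ x → P x ≡ Q x) → count P ≡ count Q
count-cong {n} {P} {Q} P≗Q =
  cong length (filter-≐ (T? ∘ P) (T? ∘ Q) (to , from) (allVecs n))
  where
  to : ∀ {x} → T (P x) → T (Q x)
  to {x} = subst T (P≗Q x)
  from : ∀ {x} → T (Q x) → T (P x)
  from {x} = subst T (sym (P≗Q x))

count-mono : {P Q : 𝔽₂^ n → Bool} → (∀ x → P x ≡ true → Q x ≡ true) → count P ℕ.≤ count Q
count-mono {n} {P} {Q} P⇒Q = length-mono-≤ (filter⁺ (T? ∘ P) (T? ∘ Q) P⇒Q′ (⊆-refl {x = allVecs n}))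
  where
  P⇒Q′ : ∀ {x y} → x ≡ y → T (P x) → T (Q y)
  P⇒Q′ {x} refl = Equivalence.from T-≡ ∘ P⇒Q x ∘ Equivalence.to T-≡

/-*-cancel : ∀ c d .{{_ : ℕ.NonZero d}} → (+ c / d) * (+ d / 1) ≡ + c / 1
/-*-cancel c (suc k) = toℚᵘ-injective (begin-equality
  toℚᵘ ((+ c / suc k) * (+ suc k / 1))          ≃⟨ toℚᵘ-homo-* (+ c / suc k) (+ suc k / 1) ⟩
  toℚᵘ (+ c / suc k) ℚᵘ.* toℚᵘ (+ suc k / 1)    ≃⟨ ℚᵘ.*-cong (toℚᵘ-fromℚᵘ (mkℚᵘ (+ c) k))
                                                             (toℚᵘ-fromℚᵘ (mkℚᵘ (+ suc k) 0)) ⟩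
  mkℚᵘ (+ c) k ℚᵘ.* mkℚᵘ (+ suc k) 0            ≃⟨ *≡* cross ⟩
  mkℚᵘ (+ c) 0                                  ≃⟨ toℚᵘ-fromℚᵘ (mkℚᵘ (+ c) 0) ⟨
  toℚᵘ (+ c / 1)                                ∎)
  where
  open ℚᵘ.≤-Reasoning
  cross : (+ c ℤ.* + suc k) ℤ.* + 1 ≡ + c ℤ.* + (suc k ℕ.* 1)
  cross = trans (ℤ.*-identityʳ _) (cong (λ d → + c ℤ.* + d) (sym (ℕ.*-identityʳ (suc k))))

*-≤⇔≤-/ : ∀ (ε : ℚ) c d .{{_ : ℕ.NonZero d}} → (ε * (+ d / 1) ≤ + c / 1) ⇔ (ε ≤ + c / d)
*-≤⇔≤-/ ε c d@(suc _) = mk⇔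
  (λ ε*d≤c → *-cancelʳ-≤-pos (+ d / 1) (subst (ε * (+ d / 1) ≤_) (sym (/-*-cancel c d)) ε*d≤c))
  (λ ε≤c/d → subst (ε * (+ d / 1) ≤_) (/-*-cancel c d) (*-monoʳ-≤-nonNeg (+ d / 1) ε≤c/d))
  where
  instance
    d-pos : Positive (+ d / 1)
    d-pos = normalize-pos d 1
    d-nonNeg : NonNegative (+ d / 1)
    d-nonNeg = pos⇒nonNeg (+ d / 1)

/1-mono-≤ : ∀ {c c′} → c ℕ.≤ c′ → + c / 1 ≤ + c′ / 1
/1-mono-≤ {c} {c′} c≤c′ = toℚᵘ-cancel-≤ (begin
  toℚᵘ (+ c / 1)   ≃⟨ toℚᵘ-fromℚᵘ (mkℚᵘ (+ c) 0) ⟩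
  mkℚᵘ (+ c) 0     ≤⟨ *≤* (ℤ.*-monoʳ-≤-nonNeg (+ 1) (ℤ.+≤+ c≤c′)) ⟩
  mkℚᵘ (+ c′) 0    ≃⟨ toℚᵘ-fromℚᵘ (mkℚᵘ (+ c′) 0) ⟨
  toℚᵘ (+ c′ / 1)  ∎)
  where open ℚᵘ.≤-Reasoning

offCount : (𝔽₂^ n → Bool) → 𝔽₂^ n → ℕ
offCount f α = count (λ x → f x ∧ not (α · x))

OCF-restrict : (f : 𝔽₂^ n → Bool) (α : 𝔽₂^ n) → OCF (λ x → f x ∧ α · x)
OCF-restrict f α = OddOn⇒OCF _ α (λ x → ∧-conicalʳ (f x) (α · x))

distance-restrict : (f : 𝔽₂^ n → Bool) (α : 𝔽₂^ n) →
                    count (λ x → f x xor (f x ∧ α · x)) ≡ offCount f α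
distance-restrict f α = count-cong (λ x → xor-∧ (f x) (α · x))
  where
  xor-∧ : ∀ a b → a xor (a ∧ b) ≡ a ∧ not b
  xor-∧ true  _ = refl
  xor-∧ false _ = refl

offCount≤distance : (f g : 𝔽₂^ n → Bool) (α : 𝔽₂^ n) → OddOn α g →
                    offCount f α ℕ.≤ count (λ x → f x xor g x)
offCount≤distance f g α αodd = count-mono (λ x → differs (αodd x))
  where
  differs : ∀ {a b c} → (b ≡ true → c ≡ true) → a ∧ not c ≡ true → a xor b ≡ true
  differs {true}  {false}         _   _ = refl
  differs {true}  {true}  {true}  _   ()
  differs {true}  {true}  {false} b⇒c _ with () ← b⇒c refl
  differs {false}                 _   ()

module _ (ε : ℚ) {n} (f : 𝔽₂^ n → Bool) where
  private instance
    2ⁿ≢0 : ℕ.NonZero (2 ^ n)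
    2ⁿ≢0 = ℕ.m^n≢0 2 n

  Far⇒offCount : Far ε f → ∀ α → ε * (+ (2 ^ n) / 1) ≤ + offCount f α / 1
  Far⇒offCount far α = Equivalence.from (*-≤⇔≤-/ ε (offCount f α) (2 ^ n))
    (subst (λ c → ε ≤ + c / 2 ^ n) (distance-restrict f α) (far _ (OCF-restrict f α)))

  offCount⇒Far : (∀ α → ε * (+ (2 ^ n) / 1) ≤ + offCount f α / 1) → Far ε f
  offCount⇒Far many g g-ocf with α , αodd ← OCF⇒OddOn g g-ocf =
    Equivalence.to (*-≤⇔≤-/ ε (count (λ x → f x xor g x)) (2 ^ n))
      (≤-trans (many α) (/1-mono-≤ (offCount≤distance f g α αodd)))

claim2p1 : (n : ℕ) (f : 𝔽₂^ n → Bool) (ε : ℚ) → 0ℚ < ε →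
    (OCF f ⇔ Σ (𝔽₂^ n) (λ α → (x : 𝔽₂^ n) → f x ≡ true → α · x ≡ true))
    × (Far ε f ⇔ ((α : 𝔽₂^ n) →
         ε * (+ (2 ^ n) / 1) ≤ (+ count (λ x → f x ∧ not (α · x))) / 1))
claim2p1 n f ε _ = OCF⇔OddOn f , mk⇔ (Far⇒offCount ε f) (offCount⇒Far ε f)
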